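{- Let $\mathcal{X}=(\Omega,S)$ be an elementary coset scheme, let $n=|\Omega|$, $m=|S_1|$, and let $k$ be the maximum valency of $\mathcal{X}$. If $\mathcal{X}$ is a pseudo-TI scheme, then $n\le m(k+1)$.
   Context: A coherent configuration on a finite set $\Omega$ is a pair $(\Omega,S)$, where $S$ is a partition of $\Omega\times\Omega$ such that the diagonal $1_\Omega$ is a union of elements of $S$, $S$ is closed under $s\mapsto s^*=\{(\beta,\alpha):(\alpha,\beta)\in s\}$, and for $r,s,t\in S$ the number $c_{rs}^t=|\alpha r\cap\beta s^*|$ (where $\alpha r=\{\beta:(\alpha,\beta)\in r\}$) does not depend on $(\alpha,\beta)\in t$. It is homogeneous if $1_\Omega\in S$; then $n_s=|\alpha s|$ is the valency and $S_j=\{s\in S:n_s=j\}$. For $r,s\in S$, $r\cdot s=\{(\alpha,\gamma):\exists\beta,\ (\alpha,\beta)\in r,(\beta,\gamma)\in s\}$, and $rs$ denotes the set of basis relations contained in $r\cdot s$. A homogeneous coherent configuration is an elementary coset scheme if there is a set $T\subseteq S_1$ with $ss^*=T$ for all $s\in S\setminus S_1$. The indistinguishing number is $c=\max_{r\in S\setminus\{1_\Omega\}}\sum_{s\in S}c_{ss^*}^r$. With $k$ the maximum valency, a homogeneous coherent configuration is a pseudo-TI scheme if $S=S_1\cup S_k$ and $c\le |S_1|k$. -}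

module Defs where

open import Data.Nat using (ℕ; zero; suc; _+_; _*_; _⊔_; _≤_)
open import Data.Fin using (Fin; zero; suc; _≟_)
open import Data.Nat.Properties using () renaming (_≟_ to _≟ℕ_)
open import Data.Sum using (_⊎_)
open import Relation.Nullary using (_×-dec_)
open import Data.Product using (_×_; _,_; proj₁; proj₂; ∃-syntax)
open import Data.Fin.Subset using (Subset; _∈_)
open import Relation.Nullary using (Dec; yes; no; ¬_)
open import Relation.Binary.PropositionalEquality using (_≡_)
open import Function.Bundles using (_⇔_)

count : ∀ {n} {P : Fin n → Set} → (∀ x → Dec (P x)) → ℕ
count {zero} d = 0
count {suc n} d with d zero
... | yes _ = suc (count (λ x → d (suc x)))
... | no _ = count (λ x → d (suc x))

sumFin : ∀ {n} → (Fin n → ℕ) → ℕ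
sumFin {zero} f = 0
sumFin {suc n} f = f zero + sumFin (λ x → f (suc x))

maxFin : ∀ {n} → (Fin n → ℕ) → ℕ
maxFin {zero} f = 0
maxFin {suc n} f = f zero ⊔ maxFin (λ x → f (suc x))

-- |α r ∩ β s*| = #{γ : (α,γ) ∈ r, (γ,β) ∈ s}, for a relation-colouring
isect : ∀ {n d} → (Fin n → Fin n → Fin d) → Fin n → Fin n → Fin d → Fin d → ℕ
isect rel α β r s =
  count (λ γ → (rel α γ ≟ r) ×-dec (rel γ β ≟ s))

-- A coherent configuration on Ω = Fin n.  The partition S of Ω×Ω into d
-- (nonempty) classes is given by the colouring rel : (α,β) ↦ class of (α,β).
record CoherentConfiguration (n : ℕ) : Set where
  field
    d       : ℕ
    rel     : Fin n → Fin n → Fin d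
    -- every class is nonempty (rep s is a chosen pair in s)
    rep     : Fin d → Fin n × Fin n
    rep-ok  : ∀ s → rel (proj₁ (rep s)) (proj₂ (rep s)) ≡ s
    -- the diagonal is a union of classes
    diag    : ∀ α β γ → rel α α ≡ rel β γ → β ≡ γ
    star    : Fin d → Fin d
    star-ok : ∀ α β → rel β α ≡ star (rel α β)
    -- intersection numbers are well defined
    coh     : ∀ r s t α β α' β' → rel α β ≡ t → rel α' β' ≡ t →
              isect rel α β r s ≡ isect rel α' β' r s

  c : Fin d → Fin d → Fin d → ℕ
  c r s t = isect rel (proj₁ (rep t)) (proj₂ (rep t)) r s

record HomogeneousCC (n : ℕ) : Set where
  field
    cc  : CoherentConfiguration n
  open CoherentConfiguration cc public
  field
    e   : Fin d
    e-ok : ∀ α β → (rel α β ≡ e) ⇔ (α ≡ β)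

  pt : Fin n
  pt = proj₁ (rep e)

  -- valency n_s = |α s| (independent of α by homogeneity)
  valency : Fin d → ℕ
  valency s = count (λ β → rel pt β ≟ s)

  maxValency : ℕ
  maxValency = maxFin valency

  numThin : ℕ
  numThin = count (λ s → valency s ≟ℕ 1)

  _∈prod_,_ : Fin d → Fin d → Fin d → Set
  t ∈prod r , s = ∀ α γ → rel α γ ≡ t → ∃[ β ] (rel α β ≡ r × rel β γ ≡ s)

  indist : ℕ
  indist = maxFin f
    where
      f : Fin d → ℕ
      f r with r ≟ e
      ... | yes _ = 0
      ... | no _ = sumFin (λ s → c s (star s) r)

IsElementaryCosetScheme : ∀ {n} → HomogeneousCC n → Set
IsElementaryCosetScheme X =
  ∃[ T ] ((∀ t → t ∈ T → valency t ≡ 1) ×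
          (∀ s → ¬ (valency s ≡ 1) → ∀ t → (t ∈ T) ⇔ (t ∈prod s , star s)))
  where open HomogeneousCC X

IsPseudoTI : ∀ {n} → HomogeneousCC n → Set
IsPseudoTI X =
  (∀ s → valency s ≡ 1 ⊎ valency s ≡ maxValency) × (indist ≤ numThin * maxValency)
  where open HomogeneousCC X

module Submission where

-- Partitioning Ω by the relation to a base point gives n = Σ_s n_s, and the m
-- thin relations contribute exactly m.  The heart of the proof is that a thin
-- relation r ⊆ s·s* forces n_s ≤ c_{ss*}^r: if (α,β) ∈ r then every γ ∈ αs
-- also satisfies (γ,β) ∈ s*, since the unique r-neighbour of α is β.  If some
-- relation s₀ is not thin, two distinct points γ ≠ γ' of pt·s₀ span a
-- non-diagonal relation r ⊆ s₀*·s₀, so r ∈ T is thin and r ⊆ s·s* for every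
-- non-thin s.  Summing, Σ_{s non-thin} n_s ≤ Σ_s c_{ss*}^r ≤ c ≤ mk, whence
-- n ≤ m + mk.

open import Defs
open import Data.Nat using (ℕ; zero; suc; _≤_; _*_; _+_; z≤n; s≤s; s≤s⁻¹; NonZero)
open import Data.Nat.Properties
  using (≤-refl; ≤-trans; ≤-reflexive; ≤-antisym; ≤∧≢⇒<; m≤m⊔n; m≤n⊔m;
         +-mono-≤; +-monoʳ-≤; +-comm; *-zeroʳ; *-identityʳ; *-suc; *-cancelˡ-≡;
         +-commutativeSemigroup; module ≤-Reasoning)
  renaming (_≟_ to _≟ℕ_; suc-injective to ℕ-suc-injective)
open import Data.Fin using (Fin; zero; suc; _≟_)
open import Data.Fin.Properties using (all?; ¬∀⟶∃¬; suc-injective)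
open import Data.Fin.Subset using (Subset; _∈_)
open import Data.Product using (_×_; _,_; proj₁; proj₂; ∃-syntax)
open import Data.Empty using (⊥-elim)
open import Function using (_∘_; _∋_)
open import Function.Bundles using (_⇔_; Equivalence)
open import Relation.Nullary using (Dec; yes; no; ¬_)
open import Relation.Binary.PropositionalEquality
  using (_≡_; _≢_; refl; sym; trans; cong; cong₂; subst; module ≡-Reasoning)
open import Algebra.Properties.CommutativeSemigroup +-commutativeSemigroup
  using (interchange)

open Equivalence using (to; from)

indicator : ∀ {p} {P : Set p} → Dec P → ℕ
indicator (yes _) = 1
indicator (no _)  = 0

indicator-mono : ∀ {p q} {P : Set p} {Q : Set q} → (P → Q) →
  (P? : Dec P) (Q? : Dec Q) → indicator P? ≤ indicator Q?
indicator-mono P→Q (yes p) (yes _) = ≤-refl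
indicator-mono P→Q (yes p) (no ¬q) = ⊥-elim (¬q (P→Q p))
indicator-mono P→Q (no _)  Q?      = z≤n

indicator-cong : ∀ {p q} {P : Set p} {Q : Set q} → (P → Q) → (Q → P) →
  (P? : Dec P) (Q? : Dec Q) → indicator P? ≡ indicator Q?
indicator-cong P→Q Q→P P? Q? =
  ≤-antisym (indicator-mono P→Q P? Q?) (indicator-mono Q→P Q? P?)

indicator-no : ∀ {p} {P : Set p} → ¬ P → (P? : Dec P) → indicator P? ≡ 0
indicator-no ¬p P? = ≤-antisym (indicator-mono ¬p P? (no λ ())) z≤n

sumFin-cong : ∀ {n} {f g : Fin n → ℕ} → (∀ x → f x ≡ g x) → sumFin f ≡ sumFin g
sumFin-cong {zero}  f≡g = refl
sumFin-cong {suc n} f≡g = cong₂ _+_ (f≡g zero) (sumFin-cong (f≡g ∘ suc))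

sumFin-mono : ∀ {n} {f g : Fin n → ℕ} → (∀ x → f x ≤ g x) → sumFin f ≤ sumFin g
sumFin-mono {zero}  f≤g = z≤n
sumFin-mono {suc n} f≤g = +-mono-≤ (f≤g zero) (sumFin-mono (f≤g ∘ suc))

sumFin-+ : ∀ {n} (f g : Fin n → ℕ) → sumFin (λ x → f x + g x) ≡ sumFin f + sumFin g
sumFin-+ {zero}  f g = refl
sumFin-+ {suc n} f g = trans (cong (f zero + g zero +_) (sumFin-+ (f ∘ suc) (g ∘ suc)))
                             (interchange (f zero) (g zero) _ _)

sumFin-const : ∀ {n} (a : ℕ) → sumFin {n} (λ _ → a) ≡ n * a
sumFin-const {zero}  a = refl
sumFin-const {suc n} a = cong (a +_) (sumFin-const {n} a)

sumFin-zero : ∀ {n} → sumFin {n} (λ _ → 0) ≡ 0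
sumFin-zero {n} = trans (sumFin-const {n} 0) (*-zeroʳ n)

sumFin-swap : ∀ {n m} (f : Fin n → Fin m → ℕ) →
  sumFin (λ i → sumFin (f i)) ≡ sumFin (λ j → sumFin (λ i → f i j))
sumFin-swap {zero}  {m} f = sym (sumFin-zero {m})
sumFin-swap {suc n} {m} f = begin
    sumFin (f zero) + sumFin (λ i → sumFin (f (suc i)))
      ≡⟨ cong (sumFin (f zero) +_) (sumFin-swap (f ∘ suc)) ⟩
    sumFin (f zero) + sumFin (λ j → sumFin (λ i → f (suc i) j))
      ≡⟨ sym (sumFin-+ (f zero) (λ j → sumFin (λ i → f (suc i) j))) ⟩
    sumFin (λ j → f zero j + sumFin (λ i → f (suc i) j)) ∎
  where open ≡-Reasoning

count-sum : ∀ {n} {P : Fin n → Set} (P? : ∀ x → Dec (P x)) →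
  count P? ≡ sumFin (λ x → indicator (P? x))
count-sum {zero}  P? = refl
count-sum {suc n} P? with P? zero
... | yes _ = cong suc (count-sum (P? ∘ suc))
... | no _  = count-sum (P? ∘ suc)

count-mono : ∀ {n} {P Q : Fin n → Set} {P? : ∀ x → Dec (P x)} {Q? : ∀ x → Dec (Q x)} →
  (∀ x → P x → Q x) → count P? ≤ count Q?
count-mono {P? = P?} {Q?} P⊆Q = begin
  count P?                            ≡⟨ count-sum P? ⟩
  sumFin (λ x → indicator (P? x))
    ≤⟨ sumFin-mono (λ x → indicator-mono (P⊆Q x) (P? x) (Q? x)) ⟩
  sumFin (λ x → indicator (Q? x))     ≡⟨ count-sum Q? ⟨
  count Q?                            ∎
  where open ≤-Reasoning

count-cong : ∀ {n} {P Q : Fin n → Set} {P? : ∀ x → Dec (P x)} {Q? : ∀ x → Dec (Q x)} →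
  (∀ x → P x → Q x) → (∀ x → Q x → P x) → count P? ≡ count Q?
count-cong P⊆Q Q⊆P = ≤-antisym (count-mono P⊆Q) (count-mono Q⊆P)

count-witness : ∀ {n} {P : Fin n → Set} (P? : ∀ x → Dec (P x)) → 1 ≤ count P? → ∃[ x ] P x
count-witness {suc n} P? pos with P? zero
... | yes p = zero , p
... | no _ with count-witness (P? ∘ suc) pos
...   | x , p = suc x , p

count-pos : ∀ {n} {P : Fin n → Set} (P? : ∀ x → Dec (P x)) → ∀ x → P x → 1 ≤ count P?
count-pos {suc n} P? x p with P? zero
count-pos {suc n} P? x       p | yes _ = s≤s z≤n
count-pos {suc n} P? zero    p | no ¬p = ⊥-elim (¬p p)
count-pos {suc n} P? (suc x) p | no _  = count-pos (P? ∘ suc) x p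

count-zero : ∀ {n} {P : Fin n → Set} (P? : ∀ x → Dec (P x)) → count P? ≡ 0 → ∀ x → ¬ P x
count-zero P? none x p with subst (1 ≤_) none (count-pos P? x p)
... | ()

count-two : ∀ {n} {P : Fin n → Set} (P? : ∀ x → Dec (P x)) → 2 ≤ count P? →
  ∃[ x ] ∃[ y ] (x ≢ y × P x × P y)
count-two {suc n} P? two with P? zero
... | yes p with count-witness (P? ∘ suc) (s≤s⁻¹ two)
...   | y , q = zero , suc y , (λ ()) , p , q
count-two {suc n} P? two | no _ with count-two (P? ∘ suc) two
... | x , y , x≢y , p , q = suc x , suc y , x≢y ∘ suc-injective , p , q

count-unique : ∀ {n} {P : Fin n → Set} (P? : ∀ x → Dec (P x)) → count P? ≡ 1 →
  ∀ {x y} → P x → P y → x ≡ y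
count-unique {suc n} P? one {x} {y} px py with P? zero
count-unique {suc n} P? one {zero}  {zero}  px py | yes _ = refl
count-unique {suc n} P? one {zero}  {suc y} px py | yes _ =
  ⊥-elim (count-zero (P? ∘ suc) (ℕ-suc-injective one) y py)
count-unique {suc n} P? one {suc x} {y}     px py | yes _ =
  ⊥-elim (count-zero (P? ∘ suc) (ℕ-suc-injective one) x px)
count-unique {suc n} P? one {zero}  {y}     px py | no ¬p = ⊥-elim (¬p px)
count-unique {suc n} P? one {suc x} {zero}  px py | no ¬p = ⊥-elim (¬p py)
count-unique {suc n} P? one {suc x} {suc y} px py | no _  =
  cong suc (count-unique (P? ∘ suc) one px py)

single-fibre : ∀ {d} (x : Fin d) → sumFin (λ s → indicator (x ≟ s)) ≡ 1
single-fibre {suc d} zero = cong suc (trans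
  (sumFin-cong {d} (λ s → indicator-no (λ ()) (zero ≟ suc s))) (sumFin-zero {d}))
single-fibre {suc d} (suc x) = trans
  (sumFin-cong (λ s → indicator-cong suc-injective (cong suc) (suc x ≟ suc s) (x ≟ s)))
  (single-fibre x)

fibres-partition : ∀ {n d} (f : Fin n → Fin d) → sumFin (λ s → count (λ β → f β ≟ s)) ≡ n
fibres-partition {n} f = begin
  sumFin (λ s → count (λ β → f β ≟ s))
    ≡⟨ sumFin-cong (λ s → count-sum (λ β → f β ≟ s)) ⟩
  sumFin (λ s → sumFin (λ β → indicator (f β ≟ s)))
    ≡⟨ sumFin-swap (λ s β → indicator (f β ≟ s)) ⟩
  sumFin (λ β → sumFin (λ s → indicator (f β ≟ s))) ≡⟨ sumFin-cong (single-fibre ∘ f) ⟩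
  sumFin {n} (λ _ → 1)                              ≡⟨ sumFin-const {n} 1 ⟩
  n * 1                                             ≡⟨ *-identityʳ n ⟩
  n                                                 ∎
  where open ≡-Reasoning

inhabited⇒nonZero : ∀ {n} → Fin n → NonZero n
inhabited⇒nonZero zero    = _
inhabited⇒nonZero (suc _) = _

maxFin-upper : ∀ {n} (f : Fin n → ℕ) (x : Fin n) → f x ≤ maxFin f
maxFin-upper f zero    = m≤m⊔n _ _
maxFin-upper f (suc x) = ≤-trans (maxFin-upper (f ∘ suc) x) (m≤n⊔m _ _)

module Configuration {n} (X : HomogeneousCC n) where
  open HomogeneousCC X

  star-involutive : ∀ s → star (star s) ≡ s
  star-involutive s = begin
    star (star s)                     ≡⟨ cong (star ∘ star) (rep-ok s) ⟨
    star (star (rel α β))             ≡⟨ cong star (star-ok α β) ⟨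
    star (rel β α)                    ≡⟨ star-ok β α ⟨
    rel α β                           ≡⟨ rep-ok s ⟩
    s                                 ∎
    where
    open ≡-Reasoning
    α = proj₁ (rep s)
    β = proj₂ (rep s)

  rel-flip : ∀ {α β s} → rel α β ≡ s → rel β α ≡ star s
  rel-flip {α} {β} αβ∈s = trans (star-ok α β) (cong star αβ∈s)

  rel-unflip : ∀ {α β s} → rel β α ≡ star s → rel α β ≡ s
  rel-unflip {s = s} βα∈s* = trans (rel-flip βα∈s*) (star-involutive s)

  -- Every row has the same number n_s of s-neighbours (the count c_{ss*}^e).
  row-size : ∀ α s → count (λ β → rel α β ≟ s) ≡ valency s
  row-size α s = begin
    count (λ β → rel α β ≟ s)   ≡⟨ count-cong {n} (λ _ p → p , rel-flip p) (λ _ → proj₁) ⟩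
    isect rel α α s (star s)    ≡⟨ coh s (star s) e α α pt pt (diagonal α) (diagonal pt) ⟩
    isect rel pt pt s (star s)  ≡⟨ count-cong {n} (λ _ → proj₁) (λ _ p → p , rel-flip p) ⟩
    valency s                   ∎
    where
    open ≡-Reasoning
    diagonal : ∀ β → rel β β ≡ e
    diagonal β = from (e-ok β β) refl

  valency-pos : ∀ s → 1 ≤ valency s
  valency-pos s =
    subst (1 ≤_) (row-size (proj₁ (rep s)) s) (count-pos _ (proj₂ (rep s)) (rep-ok s))

  pairs-of-star : ∀ s → sumFin (λ α → count (λ β → rel α β ≟ s))
                      ≡ sumFin (λ β → count (λ α → rel β α ≟ star s))
  pairs-of-star s = begin
    sumFin (λ α → count (λ β → rel α β ≟ s))
      ≡⟨ sumFin-cong (λ α → count-sum (λ β → rel α β ≟ s)) ⟩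
    sumFin (λ α → sumFin (λ β → indicator (rel α β ≟ s)))
      ≡⟨ sumFin-swap (λ α β → indicator (rel α β ≟ s)) ⟩
    sumFin (λ β → sumFin (λ α → indicator (rel α β ≟ s)))
      ≡⟨ sumFin-cong (λ β → sumFin-cong (λ α →
           indicator-cong rel-flip rel-unflip (rel α β ≟ s) (rel β α ≟ star s))) ⟩
    sumFin (λ β → sumFin (λ α → indicator (rel β α ≟ star s)))
      ≡⟨ sumFin-cong (λ β → count-sum (λ α → rel β α ≟ star s)) ⟨
    sumFin (λ β → count (λ α → rel β α ≟ star s)) ∎
    where open ≡-Reasoning

  -- n_s = n_{s*}, since by double counting n·n_s = n·n_{s*} and n ≠ 0.
  valency-star : ∀ s → valency s ≡ valency (star s)
  valency-star s = *-cancelˡ-≡ _ _ n {{inhabited⇒nonZero pt}} (begin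
    n * valency s                                  ≡⟨ sumFin-const {n} (valency s) ⟨
    sumFin {n} (λ _ → valency s)                   ≡⟨ sumFin-cong (λ α → row-size α s) ⟨
    sumFin (λ α → count (λ β → rel α β ≟ s))       ≡⟨ pairs-of-star s ⟩
    sumFin (λ β → count (λ α → rel β α ≟ star s))  ≡⟨ sumFin-cong (λ β → row-size β (star s)) ⟩
    sumFin {n} (λ _ → valency (star s))            ≡⟨ sumFin-const {n} (valency (star s)) ⟩
    n * valency (star s)                           ∎)
    where open ≡-Reasoning

  -- By coherence, if one pair of t factors through r·s then every pair does: t ⊆ r·s.
  ∈prod-intro : ∀ {r s t α γ} → rel α γ ≡ t →
                ∃[ β ] (rel α β ≡ r × rel β γ ≡ s) → t ∈prod r , s
  ∈prod-intro {r} {s} {t} {α} {γ} αγ∈t (β , path) α' γ' α'γ'∈t =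
    count-witness _ (subst (1 ≤_) (coh r s t α γ α' γ' αγ∈t α'γ'∈t) (count-pos _ β path))

  thin-functional : ∀ {r α β β'} → valency r ≡ 1 → rel α β ≡ r → rel α β' ≡ r → β ≡ β'
  thin-functional {r} {α} thin =
    count-unique (λ β → rel α β ≟ r) (trans (row-size α r) thin)

  -- Key inequality: a thin relation r ⊆ s·s* has c_{ss*}^r ≥ n_s.  For (α,β) ∈ r,
  -- every γ ∈ αs has (γ,β) ∈ s*, because s ⊆ r·s and β is the only r-neighbour of α.
  valency≤c : ∀ r s → valency r ≡ 1 → r ∈prod s , star s → valency s ≤ c s (star s) r
  valency≤c r s thin r⊆ss* = subst (_≤ c s (star s) r) (row-size α s)
    (count-mono {n} (λ γ αγ∈s → αγ∈s , towards-β αγ∈s))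
    where
    α = proj₁ (rep r)
    β = proj₂ (rep r)
    s⊆rs : s ∈prod r , s
    s⊆rs with r⊆ss* α β (rep-ok r)
    ... | δ , αδ∈s , δβ∈s* = ∈prod-intro αδ∈s (β , rep-ok r , rel-unflip δβ∈s*)
    towards-β : ∀ {γ} → rel α γ ≡ s → rel γ β ≡ star s
    towards-β {γ} αγ∈s with s⊆rs α γ αγ∈s
    ... | β' , αβ'∈r , β'γ∈s =
      rel-flip (subst (λ z → rel z γ ≡ s) (thin-functional thin αβ'∈r (rep-ok r)) β'γ∈s)

  -- c bounds Σ_s c_{ss*}^r for every non-diagonal r: deciding r ≟ e selects the
  -- branch of the summand of 'indist' at r.
  Σc≤indist : ∀ r → r ≢ e → sumFin (λ s → c s (star s) r) ≤ indist
  Σc≤indist r r≢e with r ≟ e | (_ ≤ indist ∋ maxFin-upper _ r)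
  ... | yes r≡e | _     = ⊥-elim (r≢e r≡e)
  ... | no _    | bound = bound

  size-bound : (g : Fin d → ℕ) → (∀ s → valency s ≢ 1 → valency s ≤ g s) →
               n ≤ numThin + sumFin g
  size-bound g dominates = begin
    n                                              ≡⟨ fibres-partition (rel pt) ⟨
    sumFin valency                                 ≤⟨ sumFin-mono split ⟩
    sumFin (λ s → thin? s + g s)                   ≡⟨ sumFin-+ thin? g ⟩
    sumFin thin? + sumFin g                        ≡⟨ cong (_+ sumFin g) (count-sum (λ s → valency s ≟ℕ 1)) ⟨
    numThin + sumFin g                             ∎
    where
    open ≤-Reasoning
    thin? : Fin d → ℕ
    thin? s = indicator (valency s ≟ℕ 1)
    split : ∀ s → valency s ≤ thin? s + g s
    split s with valency s ≟ℕ 1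
    ... | yes thin  = ≤-trans (≤-reflexive thin) (s≤s z≤n)
    ... | no ¬thin  = dominates s ¬thin

  module Elementary (T : Subset d)
                    (T-thin : ∀ t → t ∈ T → valency t ≡ 1)
                    (T-char : ∀ s → valency s ≢ 1 → ∀ t → (t ∈ T) ⇔ (t ∈prod s , star s)) where

    -- A non-thin s₀ yields a non-diagonal r ∈ T: the relation between two
    -- distinct points of pt·s₀, which lies in s₀*·s₀ through pt.
    nondiagonal-in-T : ∀ s₀ → valency s₀ ≢ 1 → ∃[ r ] (r ≢ e × r ∈ T)
    nondiagonal-in-T s₀ ¬thin
      with count-two (λ β → rel pt β ≟ s₀) (≤∧≢⇒< (valency-pos s₀) (¬thin ∘ sym))
    ... | γ , γ' , γ≢γ' , ptγ∈s₀ , ptγ'∈s₀ =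
      rel γ γ' , γ≢γ' ∘ to (e-ok γ γ') ,
      from (T-char (star s₀) ¬thin* (rel γ γ')) r⊆s₀*s₀
      where
      ¬thin* : valency (star s₀) ≢ 1
      ¬thin* = ¬thin ∘ trans (valency-star s₀)
      r⊆s₀*s₀ : rel γ γ' ∈prod star s₀ , star (star s₀)
      r⊆s₀*s₀ = ∈prod-intro refl
        (pt , rel-flip ptγ∈s₀ , trans ptγ'∈s₀ (sym (star-involutive s₀)))

    thick-dominated : ∃[ g ] ((∀ s → valency s ≢ 1 → valency s ≤ g s) × sumFin g ≤ indist)
    thick-dominated with all? (λ s → valency s ≟ℕ 1)
    ... | yes all-thin =
      (λ _ → 0) ,
      (λ s ¬thin → ⊥-elim (¬thin (all-thin s))) ,
      ≤-trans (≤-reflexive (sumFin-zero {d})) z≤n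
    ... | no ¬all-thin with ¬∀⟶∃¬ d _ (λ s → valency s ≟ℕ 1) ¬all-thin
    ...   | s₀ , ¬thin with nondiagonal-in-T s₀ ¬thin
    ...     | r , r≢e , r∈T =
      (λ s → c s (star s) r) ,
      (λ s ¬thin-s → valency≤c r s (T-thin r r∈T) (to (T-char s ¬thin-s r) r∈T)) ,
      Σc≤indist r r≢e

proposition3p8 : ∀ {n} (X : HomogeneousCC n) →
    IsElementaryCosetScheme X → IsPseudoTI X →
    n ≤ HomogeneousCC.numThin X * (HomogeneousCC.maxValency X + 1)
proposition3p8 {n} X (T , T-thin , T-char) (_ , c≤mk)
  with Configuration.Elementary.thick-dominated X T T-thin T-char
... | g , dominates , Σg≤c = begin
  n                               ≤⟨ size-bound g dominates ⟩
  numThin + sumFin g              ≤⟨ +-monoʳ-≤ numThin (≤-trans Σg≤c c≤mk) ⟩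
  numThin + numThin * maxValency  ≡⟨ *-suc numThin maxValency ⟨
  numThin * suc maxValency        ≡⟨ cong (numThin *_) (+-comm 1 maxValency) ⟩
  numThin * (maxValency + 1)      ∎
  where
  open HomogeneousCC X
  open Configuration X
  open ≤-Reasoning
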